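{- Let $G=(V,E)$ be an undirected graph with positive edge weights, let $s\in V$ and $\phi\ge 0$, and let $X := V\setminus \mathrm{ct}(s,\phi)$. Then $X$ respects the extreme sets of $G$: for every extreme set $Y$ of $G$, either $Y\subseteq X$, or $X\subseteq Y$, or $X\cap Y=\emptyset$.
   Context: For $Z\subseteq V$, $\delta(Z)$ is the total weight of edges with exactly one endpoint in $Z$. A nonempty set $Y\subsetneq V$ is an extreme set if $\delta(Y')>\delta(Y)$ for every nonempty proper subset $Y'\subsetneq Y$. For distinct $s,t\in V$, $\lambda(s,t)$ is the minimum of $\delta(Z)$ over all $Z\subseteq V$ containing exactly one of $s,t$ (the max-flow value between $s$ and $t$). The cut threshold is $\mathrm{ct}(s,\phi) := \{t\in V\setminus\{s\} : \lambda(s,t)\le\phi\}$; note $s\in X$.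
   Formalization: The edge weights and the parameter φ are rational. -}

module Defs where

open import Data.Nat using (ℕ; zero; suc)
open import Data.Bool using (Bool; true; false; _xor_; if_then_else_)
open import Data.Fin using (Fin)
open import Data.Vec using (Vec; []; _∷_; lookup)
open import Data.List using (List; []; _∷_; map; _++_; foldr; filter)
open import Data.Rational using (ℚ; 0ℚ; _+_; _≤_; _<_; _⊓_)
open import Data.Fin.Subset using (Subset; _∈_; _∉_; _⊆_; Nonempty; ⁅_⁆; ⊤)
open import Relation.Binary.PropositionalEquality using (_≡_; _≢_)
open import Relation.Nullary.Decidable using (does)
open import Data.Bool.Properties using (_≟_)
open import Data.Sum using (_⊎_)
open import Data.Product using (_×_)

sumFin : ∀ {n} → (Fin n → ℚ) → ℚ
sumFin {zero}  f = 0ℚ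
sumFin {suc n} f = f Fin.zero + sumFin (λ i → f (Fin.suc i))

-- An undirected graph on vertex set V = Fin n with positive edge weights,
-- given by its symmetric weight matrix: w u v > 0 iff uv is an edge (of that
-- weight), w u v = 0 iff there is no edge; no loops.
record WGraph (n : ℕ) : Set where
  field
    w        : Fin n → Fin n → ℚ
    w-sym    : ∀ u v → w u v ≡ w v u
    w-nonneg : ∀ u v → 0ℚ ≤ w u v
    w-noloop : ∀ u → w u u ≡ 0ℚ

open WGraph public

inB : ∀ {n} → Fin n → Subset n → Bool
inB v Z = lookup Z v

-- δ(Z): total weight of edges with exactly one endpoint in Z.
-- Each such edge {u,v} with u ∈ Z, v ∉ Z is counted once (ordered pair (u,v)).
δ : ∀ {n} → WGraph n → Subset n → ℚ
δ G Z = sumFin (λ u → sumFin (λ v →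
          if inB u Z then (if inB v Z then 0ℚ else w G u v) else 0ℚ))

allSubsets : (n : ℕ) → List (Subset n)
allSubsets zero    = [] ∷ []
allSubsets (suc n) = map (true ∷_) (allSubsets n) ++ map (false ∷_) (allSubsets n)

separates : ∀ {n} → Fin n → Fin n → Subset n → Bool
separates s t Z = inB s Z xor inB t Z

-- λ(s,t) = min { δ(Z) : Z ⊆ V contains exactly one of s,t }.
-- The fold starts from δ(⁅ s ⁆), which is itself such a value whenever s ≢ t,
-- so for distinct s, t this is exactly the minimum.
lambda : ∀ {n} → WGraph n → Fin n → Fin n → ℚ
lambda {n} G s t =
  foldr (λ Z m → (if separates s t Z then δ G Z else δ G ⁅ s ⁆) ⊓ m)
        (δ G ⁅ s ⁆) (allSubsets n)

Extreme : ∀ {n} → WGraph n → Subset n → Set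
Extreme G Y =
  Nonempty Y × Y ≢ ⊤ ×
  (∀ Y' → Nonempty Y' → Y' ⊆ Y → Y' ≢ Y → δ G Y < δ G Y')

InCt : ∀ {n} → WGraph n → Fin n → ℚ → Fin n → Set
InCt G s φ t = t ≢ s × lambda G s t ≤ φ

InX : ∀ {n} → WGraph n → Fin n → ℚ → Fin n → Set
InX G s φ v = InCt G s φ v → Data.Empty.⊥
  where import Data.Empty

-- Cuts are submodular: δ(Y ∩ Z) + δ(Y ∪ Z) ≤ δ(Y) + δ(Z). Suppose some t ∈ Y
-- lies in ct(s,φ), and take a minimum s-t cut Z on the side of t, so s ∉ Z and
-- δ(Z) ≤ φ. If Y ⊈ Z then Y ∩ Z is a nonempty proper subset of the extreme set
-- Y, so δ(Y ∩ Z) > δ(Y) and submodularity gives δ(Y ∪ Z) < δ(Z) ≤ φ. A vertex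
-- v of X is never in Z (else λ(s,v) ≤ δ(Z) ≤ φ), so when Y ∪ Z separates s
-- from v we get λ(s,v) < φ, contradicting v ∈ X. If s ∈ Y this rules out
-- v ∈ X ∖ Y (so X ⊆ Y, witness of Y ⊈ Z being s); if s ∉ Y it rules out
-- v ∈ X ∩ Y (witness v). If no such t exists, Y ⊆ X.
module Submission where

open import Defs
open import Data.Nat using (ℕ; zero; suc)
open import Data.Fin using (Fin)
open import Data.Fin.Subset using (Subset; _∈_; _∉_; _∩_; _∪_; ∁; ⁅_⁆)
open import Data.Fin.Subset.Properties
  using (_∈?_; p∩q⊆p; p∩q⊆q; x∈p∩q⁺; x∈p∪q⁺; x∈p∪q⁻; x∈⁅x⁆; x∈⁅y⁆⇒x≡y; x∉p⇒x∈∁p; x∈p⇒x∉∁p)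
open import Data.Fin.Properties using (any?) renaming (_≟_ to _≟ᶠ_)
open import Data.Bool using (Bool; true; false; not; _∧_; _∨_; _xor_; if_then_else_)
open import Data.Bool.Properties using (¬-not; xor-same)
open import Data.Vec using ([]; _∷_; lookup)
open import Data.Vec.Properties using (lookup-zipWith; lookup-map; []=⇒lookup; lookup⇒[]=)
open import Data.Rational using (ℚ; 0ℚ; _+_; _≤_; _<_; _⊓_)
import Data.Rational.Properties as ℚ
open import Algebra.Bundles using (CommutativeMonoid)
open import Algebra.Properties.CommutativeSemigroup
  (CommutativeMonoid.commutativeSemigroup ℚ.+-0-commutativeMonoid) using (interchange)
open import Data.List using (List; []; _∷_; foldr)
import Data.List as List
open import Data.List.Membership.Propositional using () renaming (_∈_ to _∈ˡ_)
open import Data.List.Membership.Propositional.Properties using (∈-map⁺; ∈-++⁺ˡ; ∈-++⁺ʳ)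
open import Data.List.Relation.Unary.Any using (here; there)
open import Data.Product using (∃; _×_; _,_)
open import Data.Sum using (_⊎_; inj₁; inj₂)
open import Relation.Nullary using (¬_; Dec; yes; no; ¬?; contradiction)
open import Relation.Nullary.Decidable using (_×-dec_; decidable-stable)
open import Relation.Binary.PropositionalEquality

sumFin-cong : ∀ {n} {f g : Fin n → ℚ} → (∀ i → f i ≡ g i) → sumFin f ≡ sumFin g
sumFin-cong {zero}  f≡g = refl
sumFin-cong {suc n} f≡g = cong₂ _+_ (f≡g Fin.zero) (sumFin-cong (λ i → f≡g (Fin.suc i)))

sumFin-mono-≤ : ∀ {n} {f g : Fin n → ℚ} → (∀ i → f i ≤ g i) → sumFin f ≤ sumFin g
sumFin-mono-≤ {zero}  f≤g = ℚ.≤-refl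
sumFin-mono-≤ {suc n} f≤g = ℚ.+-mono-≤ (f≤g Fin.zero) (sumFin-mono-≤ (λ i → f≤g (Fin.suc i)))

sumFin-distrib-+ : ∀ {n} (f g : Fin n → ℚ) →
                   sumFin (λ i → f i + g i) ≡ sumFin f + sumFin g
sumFin-distrib-+ {zero}  f g = refl
sumFin-distrib-+ {suc n} f g = begin
  (f₀ + g₀) + sumFin (λ i → f (Fin.suc i) + g (Fin.suc i))
    ≡⟨ cong ((f₀ + g₀) +_) (sumFin-distrib-+ (λ i → f (Fin.suc i)) (λ i → g (Fin.suc i))) ⟩
  (f₀ + g₀) + (sumFin (λ i → f (Fin.suc i)) + sumFin (λ i → g (Fin.suc i)))
    ≡⟨ interchange f₀ g₀ _ _ ⟩
  sumFin f + sumFin g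
    ∎
  where
  open ≡-Reasoning
  f₀ = f Fin.zero
  g₀ = g Fin.zero

sumFin-zero : ∀ {n} → sumFin {n} (λ _ → 0ℚ) ≡ 0ℚ
sumFin-zero {zero}  = refl
sumFin-zero {suc n} = trans (ℚ.+-identityˡ _) (sumFin-zero {n})

sumFin-swap : ∀ {m n} (f : Fin m → Fin n → ℚ) →
              sumFin (λ u → sumFin (f u)) ≡ sumFin (λ v → sumFin (λ u → f u v))
sumFin-swap {zero}  {n} f = sym (sumFin-zero {n})
sumFin-swap {suc m} f =
  trans (cong (sumFin (f Fin.zero) +_) (sumFin-swap (λ u → f (Fin.suc u))))
        (sym (sumFin-distrib-+ (f Fin.zero) (λ v → sumFin (λ u → f (Fin.suc u) v))))

sumFin²-distrib-+ : ∀ {n} (f g : Fin n → Fin n → ℚ) →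
                    sumFin (λ u → sumFin (λ v → f u v + g u v))
                    ≡ sumFin (λ u → sumFin (f u)) + sumFin (λ u → sumFin (g u))
sumFin²-distrib-+ f g =
  trans (sumFin-cong (λ u → sumFin-distrib-+ (f u) (g u)))
        (sumFin-distrib-+ (λ u → sumFin (f u)) (λ u → sumFin (g u)))

crossing : Bool → Bool → ℚ → ℚ
crossing inU inV x = if inU then (if inV then 0ℚ else x) else 0ℚ

crossingWeight : ∀ {n} → WGraph n → Subset n → Fin n → Fin n → ℚ
crossingWeight G Z u v = crossing (inB u Z) (inB v Z) (w G u v)

crossing-submodular : ∀ x → 0ℚ ≤ x → ∀ a b c d →
  crossing (a ∧ b) (c ∧ d) x + crossing (a ∨ b) (c ∨ d) x ≤ crossing a c x + crossing b d x
crossing-submodular x 0≤x false false c     d     = ℚ.≤-refl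
crossing-submodular x 0≤x false true  false d     = ℚ.≤-refl
crossing-submodular x 0≤x false true  true  false = ℚ.+-mono-≤ ℚ.≤-refl 0≤x
crossing-submodular x 0≤x false true  true  true  = ℚ.≤-refl
crossing-submodular x 0≤x true  false false false = ℚ.≤-reflexive (ℚ.+-comm 0ℚ x)
crossing-submodular x 0≤x true  false false true  = ℚ.+-mono-≤ 0≤x ℚ.≤-refl
crossing-submodular x 0≤x true  false true  d     = ℚ.≤-refl
crossing-submodular x 0≤x true  true  false d     = ℚ.≤-refl
crossing-submodular x 0≤x true  true  true  false = ℚ.≤-reflexive (ℚ.+-comm x 0ℚ)
crossing-submodular x 0≤x true  true  true  true  = ℚ.≤-refl

crossing-not : ∀ a b x → crossing (not a) (not b) x ≡ crossing b a x
crossing-not false false x = refl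
crossing-not false true  x = refl
crossing-not true  false x = refl
crossing-not true  true  x = refl

δ-submodular : ∀ {n} (G : WGraph n) (A B : Subset n) →
               δ G (A ∩ B) + δ G (A ∪ B) ≤ δ G A + δ G B
δ-submodular G A B =
  subst₂ _≤_ (sumFin²-distrib-+ (crossingWeight G (A ∩ B)) (crossingWeight G (A ∪ B)))
             (sumFin²-distrib-+ (crossingWeight G A) (crossingWeight G B))
    (sumFin-mono-≤ (λ u → sumFin-mono-≤ (λ v → pointwise u v)))
  where
  pointwise : ∀ u v → crossingWeight G (A ∩ B) u v + crossingWeight G (A ∪ B) u v
                      ≤ crossingWeight G A u v + crossingWeight G B u v
  pointwise u v
    rewrite lookup-zipWith _∧_ u A B | lookup-zipWith _∧_ v A B
          | lookup-zipWith _∨_ u A B | lookup-zipWith _∨_ v A B =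
    crossing-submodular (w G u v) (w-nonneg G u v)
      (lookup A u) (lookup B u) (lookup A v) (lookup B v)

δ-∁ : ∀ {n} (G : WGraph n) (Z : Subset n) → δ G (∁ Z) ≡ δ G Z
δ-∁ G Z = trans (sumFin-cong (λ u → sumFin-cong (λ v → pointwise u v)))
                (sym (sumFin-swap (crossingWeight G Z)))
  where
  pointwise : ∀ u v → crossingWeight G (∁ Z) u v ≡ crossingWeight G Z v u
  pointwise u v rewrite lookup-map u not Z | lookup-map v not Z | w-sym G u v =
    crossing-not (lookup Z u) (lookup Z v) (w G v u)

∉⇒lookup≡false : ∀ {n} {x : Fin n} {p : Subset n} → x ∉ p → lookup p x ≡ false
∉⇒lookup≡false {x = x} {p} x∉p = ¬-not (λ px≡true → x∉p (lookup⇒[]= x p px≡true))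

lookup≡false⇒∉ : ∀ {n} {x : Fin n} {p : Subset n} → lookup p x ≡ false → x ∉ p
lookup≡false⇒∉ px≡false x∈p with () ← trans (sym ([]=⇒lookup x∈p)) px≡false

separates-∈-∉ : ∀ {n} {s t : Fin n} {Z : Subset n} → s ∈ Z → t ∉ Z → separates s t Z ≡ true
separates-∈-∉ s∈Z t∉Z = cong₂ _xor_ ([]=⇒lookup s∈Z) (∉⇒lookup≡false t∉Z)

separates-∉-∈ : ∀ {n} {s t : Fin n} {Z : Subset n} → s ∉ Z → t ∈ Z → separates s t Z ≡ true
separates-∉-∈ s∉Z t∈Z = cong₂ _xor_ (∉⇒lookup≡false s∉Z) ([]=⇒lookup t∈Z)

separates⇒≢ : ∀ {n} {s t : Fin n} (Z : Subset n) → separates s t Z ≡ true → t ≢ s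
separates⇒≢ {s = s} Z sep refl with () ← trans (sym sep) (xor-same (lookup Z s))

separates⇒exactly-one : ∀ {n} {s t : Fin n} (Z : Subset n) → separates s t Z ≡ true →
                        (s ∈ Z × t ∉ Z) ⊎ (s ∉ Z × t ∈ Z)
separates⇒exactly-one {s = s} {t} Z sep with lookup Z s in s∈? | lookup Z t in t∈?
... | true  | false = inj₁ (lookup⇒[]= s Z s∈? , lookup≡false⇒∉ t∈?)
... | false | true  = inj₂ (lookup≡false⇒∉ s∈? , lookup⇒[]= t Z t∈?)
... | true  | true  with () ← sep
... | false | false with () ← sep

⁅s⁆-separates : ∀ {n} {s t : Fin n} → t ≢ s → separates s t ⁅ s ⁆ ≡ true
⁅s⁆-separates {s = s} t≢s = separates-∈-∉ (x∈⁅x⁆ s) (λ t∈⁅s⁆ → t≢s (x∈⁅y⁆⇒x≡y s t∈⁅s⁆))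

allSubsets-complete : ∀ {n} (Z : Subset n) → Z ∈ˡ allSubsets n
allSubsets-complete {zero}  [] = here refl
allSubsets-complete {suc n} (true ∷ Z) =
  ∈-++⁺ˡ (∈-map⁺ (true ∷_) (allSubsets-complete Z))
allSubsets-complete {suc n} (false ∷ Z) =
  ∈-++⁺ʳ (List.map (true ∷_) (allSubsets n)) (∈-map⁺ (false ∷_) (allSubsets-complete Z))

module _ {A : Set} (g : A → ℚ) (i : ℚ) where

  foldr-⊓ : List A → ℚ
  foldr-⊓ = foldr (λ a m → g a ⊓ m) i

  foldr-⊓-≤ : ∀ {a xs} → a ∈ˡ xs → foldr-⊓ xs ≤ g a
  foldr-⊓-≤ {xs = x ∷ xs} (here refl) = ℚ.p⊓q≤p (g x) _
  foldr-⊓-≤ {xs = x ∷ xs} (there a∈xs) = ℚ.≤-trans (ℚ.p⊓q≤q (g x) _) (foldr-⊓-≤ a∈xs)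

  foldr-⊓-preserves : (P : ℚ → Set) → P i → (∀ a → P (g a)) → ∀ xs → P (foldr-⊓ xs)
  foldr-⊓-preserves P Pi Pg []       = Pi
  foldr-⊓-preserves P Pi Pg (x ∷ xs) with ℚ.⊓-sel (g x) (foldr-⊓ xs)
  ... | inj₁ eq = subst P (sym eq) (Pg x)
  ... | inj₂ eq = subst P (sym eq) (foldr-⊓-preserves P Pi Pg xs)

module _ {n} (G : WGraph n) (s t : Fin n) where

  private
    separatingCut : Subset n → ℚ
    separatingCut Z = if separates s t Z then δ G Z else δ G ⁅ s ⁆

  lambda-≤-δ : ∀ Z → separates s t Z ≡ true → lambda G s t ≤ δ G Z
  lambda-≤-δ Z sep =
    subst (lambda G s t ≤_) (cong (λ b → if b then δ G Z else δ G ⁅ s ⁆) sep)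
      (foldr-⊓-≤ separatingCut (δ G ⁅ s ⁆) (allSubsets-complete Z))

  lambda-attained : t ≢ s → ∃ λ Z → separates s t Z ≡ true × δ G Z ≡ lambda G s t
  lambda-attained t≢s =
    foldr-⊓-preserves separatingCut (δ G ⁅ s ⁆) Attained
      (⁅ s ⁆ , ⁅s⁆-separates t≢s , refl) attained (allSubsets n)
    where
    Attained : ℚ → Set
    Attained x = ∃ λ Z → separates s t Z ≡ true × δ G Z ≡ x
    attained : ∀ Z → Attained (separatingCut Z)
    attained Z with separates s t Z in sep
    ... | true  = Z , sep , refl
    ... | false = ⁅ s ⁆ , ⁅s⁆-separates t≢s , refl

  lambda-attained-on-t-side : t ≢ s → ∃ λ Z → t ∈ Z × s ∉ Z × δ G Z ≡ lambda G s t
  lambda-attained-on-t-side t≢s with lambda-attained t≢s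
  ... | Z , sep , δZ≡λ with separates⇒exactly-one Z sep
  ...   | inj₁ (s∈Z , t∉Z) = ∁ Z , x∉p⇒x∈∁p t∉Z , x∈p⇒x∉∁p s∈Z , trans (δ-∁ G Z) δZ≡λ
  ...   | inj₂ (s∉Z , t∈Z) = Z , t∈Z , s∉Z , δZ≡λ

extreme-∪-< : ∀ {n} (G : WGraph n) {Y Z : Subset n} {t x : Fin n} → Extreme G Y →
              t ∈ Y → t ∈ Z → x ∈ Y → x ∉ Z → δ G (Y ∪ Z) < δ G Z
extreme-∪-< G {Y} {Z} {t} {x} (_ , _ , minimal) t∈Y t∈Z x∈Y x∉Z
  with δ G (Y ∪ Z) ℚ.<? δ G Z
... | yes δY∪Z<δZ = δY∪Z<δZ
... | no  δY∪Z≮δZ =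
  contradiction (ℚ.<-≤-trans (ℚ.+-mono-<-≤ δY<δY∩Z (ℚ.≮⇒≥ δY∪Z≮δZ)) (δ-submodular G Y Z))
                (ℚ.<-irrefl refl)
  where
  Y∩Z≢Y : Y ∩ Z ≢ Y
  Y∩Z≢Y Y∩Z≡Y = x∉Z (p∩q⊆q Y Z (subst (x ∈_) (sym Y∩Z≡Y) x∈Y))

  δY<δY∩Z : δ G Y < δ G (Y ∩ Z)
  δY<δY∩Z = minimal (Y ∩ Z) (t , x∈p∩q⁺ (t∈Y , t∈Z)) (p∩q⊆p Y Z) Y∩Z≢Y

∉-∪ : ∀ {n} {x : Fin n} {p q : Subset n} → x ∉ p → x ∉ q → x ∉ p ∪ q
∉-∪ {p = p} {q} x∉p x∉q x∈p∪q with x∈p∪q⁻ p q x∈p∪q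
... | inj₁ x∈p = x∉p x∈p
... | inj₂ x∈q = x∉q x∈q

module _ {n} (G : WGraph n) {s : Fin n} {φ : ℚ} where

  InX⇒φ<δ : ∀ {v} W → InX G s φ v → separates s v W ≡ true → φ < δ G W
  InX⇒φ<δ {v} W v∈X sep =
    ℚ.<-≤-trans (ℚ.≰⇒> (λ λsv≤φ → v∈X (separates⇒≢ W sep , λsv≤φ))) (lambda-≤-δ G s v W sep)

  InX⇒∉ : ∀ {v Z} → InX G s φ v → s ∉ Z → δ G Z ≤ φ → v ∉ Z
  InX⇒∉ {Z = Z} v∈X s∉Z δZ≤φ v∈Z =
    ℚ.<-irrefl refl (ℚ.<-≤-trans (InX⇒φ<δ Z v∈X (separates-∉-∈ s∉Z v∈Z)) δZ≤φ)

  ∪-separates⇒¬InX : ∀ {Y Z t x v} → Extreme G Y → t ∈ Y → t ∈ Z → δ G Z ≤ φ →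
                     x ∈ Y → x ∉ Z → separates s v (Y ∪ Z) ≡ true → ¬ InX G s φ v
  ∪-separates⇒¬InX {Y} {Z} Y-extreme t∈Y t∈Z δZ≤φ x∈Y x∉Z sep v∈X =
    ℚ.<-irrefl refl
      (ℚ.<-≤-trans (ℚ.<-trans (InX⇒φ<δ (Y ∪ Z) v∈X sep) (extreme-∪-< G Y-extreme t∈Y t∈Z x∈Y x∉Z)) δZ≤φ)

InCt? : ∀ {n} (G : WGraph n) s φ v → Dec (InCt G s φ v)
InCt? G s φ v = ¬? (v ≟ᶠ s) ×-dec (lambda G s v ℚ.≤? φ)

lemma2p3 : ∀ {n : ℕ} (G : WGraph n) (s : Fin n) (φ : ℚ) → 0ℚ ≤ φ →
           ∀ (Y : Subset n) → Extreme G Y →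
           (∀ v → v ∈ Y → InX G s φ v)
           ⊎ (∀ v → InX G s φ v → v ∈ Y)
           ⊎ (∀ v → ¬ (v ∈ Y × InX G s φ v))
lemma2p3 G s φ _ Y Y-extreme with any? (λ t → (t ∈? Y) ×-dec InCt? G s φ t)
... | no ∄t = inj₁ (λ v v∈Y v∈ct → ∄t (v , v∈Y , v∈ct))
... | yes (t , t∈Y , t≢s , λst≤φ) with lambda-attained-on-t-side G s t t≢s
...   | Z , t∈Z , s∉Z , δZ≡λst with δZ≤φ ← subst (_≤ φ) (sym δZ≡λst) λst≤φ | s ∈? Y
...     | yes s∈Y = inj₂ (inj₁ λ v v∈X → decidable-stable (v ∈? Y) λ v∉Y →
            ∪-separates⇒¬InX G Y-extreme t∈Y t∈Z δZ≤φ s∈Y s∉Z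
              (separates-∈-∉ (x∈p∪q⁺ (inj₁ s∈Y)) (∉-∪ v∉Y (InX⇒∉ G v∈X s∉Z δZ≤φ))) v∈X)
...     | no  s∉Y = inj₂ (inj₂ λ v (v∈Y , v∈X) →
            ∪-separates⇒¬InX G Y-extreme t∈Y t∈Z δZ≤φ v∈Y (InX⇒∉ G v∈X s∉Z δZ≤φ)
              (separates-∉-∈ (∉-∪ s∉Y s∉Z) (x∈p∪q⁺ (inj₁ v∈Y))) v∈X)
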